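{- Let $G$ be a finite simple graph and let $A\subseteq V(G)$ be an efficient dominating set (perfect code), i.e. $A$ is independent and every vertex of $V(G)\setminus A$ is adjacent to exactly one vertex of $A$. Then $A$ is Complementary Component Dominant and hence $0_2$-invoking.
   Context: $H\subseteq V(G)$ is Complementary Component Dominant (CCD) if (i) for all adjacent $x,y\in H$, $x$ and $y$ have the same number of neighbours in $V(G)\setminus H$, and (ii) for all adjacent $u,v\in V(G)\setminus H$, $u$ and $v$ have the same number of neighbours in $H$. Diffusion: a configuration assigns an integer stack size $|v|$ to each vertex; firing a configuration $C$ changes each $v$ simultaneously from $|v|^C$ to $|v|^C + |\{u\in N(v): |u|^C>|v|^C\}| - |\{u\in N(v): |u|^C<|v|^C\}|$. The 0-configuration has all stack sizes $0$. A perturbation of $H$ from the 0-configuration is the step in which every vertex of $H$ sends one chip to each of its neighbours. $H$ is $0_2$-invoking if this perturbation followed by one ordinary firing yields the 0-configuration. -}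

module Defs where

open import Data.Nat using (ℕ)
open import Data.Bool using (Bool; true; false; _∧_; not; if_then_else_)
open import Data.Fin using (Fin)
open import Data.List using (List; map; allFin)
open import Data.Nat.ListAction using (sum)
open import Data.Integer using (ℤ; +_; _+_; _-_; _<?_)
open import Relation.Nullary.Decidable using (⌊_⌋)
open import Relation.Binary.PropositionalEquality using (_≡_)
open import Data.Product using (_×_)

record Graph (n : ℕ) : Set where
  field
    adj    : Fin n → Fin n → Bool
    sym    : ∀ u v → adj u v ≡ adj v u
    irrefl : ∀ v → adj v v ≡ false
open Graph public

VSet : ℕ → Set
VSet n = Fin n → Bool

count : {n : ℕ} → (Fin n → Bool) → ℕ
count {n} p = sum (map (λ i → if p i then 1 else 0) (allFin n))

nbrsIn : {n : ℕ} → Graph n → VSet n → Fin n → ℕ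
nbrsIn G S v = count (λ u → adj G v u ∧ S u)

complement : {n : ℕ} → VSet n → VSet n
complement S v = not (S v)

deg : {n : ℕ} → Graph n → Fin n → ℕ
deg G v = count (adj G v)

IsEfficientDominating : {n : ℕ} → Graph n → VSet n → Set
IsEfficientDominating G A =
  (∀ x y → A x ≡ true → A y ≡ true → adj G x y ≡ false)
  × (∀ v → A v ≡ false → nbrsIn G A v ≡ 1)

IsCCD : {n : ℕ} → Graph n → VSet n → Set
IsCCD G H =
  (∀ x y → H x ≡ true → H y ≡ true → adj G x y ≡ true →
     nbrsIn G (complement H) x ≡ nbrsIn G (complement H) y)
  × (∀ u v → H u ≡ false → H v ≡ false → adj G u v ≡ true →
     nbrsIn G H u ≡ nbrsIn G H v)

Config : ℕ → Set
Config n = Fin n → ℤ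

zeroConfig : {n : ℕ} → Config n
zeroConfig _ = + 0

fire : {n : ℕ} → Graph n → Config n → Config n
fire G C v =
  C v + + count (λ u → adj G v u ∧ ⌊ C v <? C u ⌋)
      - + count (λ u → adj G v u ∧ ⌊ C u <? C v ⌋)

-- perturbation of H from the 0-configuration: every vertex of H sends one chip
-- to each of its neighbours
perturb : {n : ℕ} → Graph n → VSet n → Config n
perturb G H v = + nbrsIn G H v - (if H v then + deg G v else + 0)

Is0₂Invoking : {n : ℕ} → Graph n → VSet n → Set
Is0₂Invoking G H = ∀ v → fire G (perturb G H) v ≡ + 0

-- An efficient dominating set is independent and every vertex outside it has exactly one
-- neighbour in it; we argue for any independent H whose outside vertices all have the same
-- number k + 1 of neighbours in H. Perturbing H leaves −deg v on each v ∈ H and k + 1 on each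
-- outside vertex. A vertex of H lies strictly below all its neighbours (they are outside), so
-- firing returns its deg v chips; an outside vertex is below no neighbour and lies strictly
-- above exactly its k + 1 neighbours in H, so firing removes the k + 1 chips it received.

module Submission where

open import Defs
open import Data.Nat using (ℕ; suc; s≤s; z≤n)
open import Data.Empty using (⊥; ⊥-elim)
open import Data.Product using (_×_; _,_)
open import Data.Bool using (Bool; true; false; _∧_; if_then_else_)
open import Data.Bool.Properties using (∧-zeroʳ; ∧-identityʳ)
open import Data.Fin using (Fin)
open import Data.List using (List; []; _∷_; map; allFin)
open import Data.List.Properties using (map-cong)
open import Data.Nat.ListAction using (sum)
open import Data.Integer using (+_; _+_; _-_; -_; _<_; _≤_; _<?_; +<+)
open import Data.Integer.Properties
  using (neg-≤-pos; ≤-<-trans; ≤⇒≯; <-irrefl; ≤-refl; <⇒≤; <-asym; +-identityˡ; +-identityʳ; +-inverseˡ; +-inverseʳ)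
open import Relation.Nullary using (Dec; ¬_)
open import Relation.Nullary.Decidable using (⌊_⌋; isYes≗does; dec-true; dec-false)
open import Relation.Binary.PropositionalEquality using (_≡_; refl; trans; cong; cong₂)
import Relation.Binary.PropositionalEquality as ≡
open ≡.≡-Reasoning

sum-map-zero : {A : Set} (xs : List A) → sum (map (λ _ → 0) xs) ≡ 0
sum-map-zero []       = refl
sum-map-zero (_ ∷ xs) = sum-map-zero xs

count-cong : {n : ℕ} {p q : Fin n → Bool} → (∀ u → p u ≡ q u) → count p ≡ count q
count-cong {n} p≗q = cong sum (map-cong (λ u → cong (if_then 1 else 0) (p≗q u)) (allFin n))

count-false : {n : ℕ} {p : Fin n → Bool} → (∀ u → p u ≡ false) → count p ≡ 0
count-false {n} p≗false = trans (count-cong p≗false) (sum-map-zero (allFin n))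

isYes-true : {P : Set} (d : Dec P) → P → ⌊ d ⌋ ≡ true
isYes-true d p = trans (isYes≗does d) (dec-true d p)

isYes-false : {P : Set} (d : Dec P) → ¬ P → ⌊ d ⌋ ≡ false
isYes-false d ¬p = trans (isYes≗does d) (dec-false d ¬p)

fire-cong : {n : ℕ} (G : Graph n) {C D : Config n} → (∀ u → C u ≡ D u) → ∀ v → fire G C v ≡ fire G D v
fire-cong G {C} {D} C≗D v rewrite C≗D v =
  cong₂ (λ a b → D v + + a - + b)
    (count-cong λ u → cong (λ c → adj G v u ∧ ⌊ D v <? c ⌋) (C≗D u))
    (count-cong λ u → cong (λ c → adj G v u ∧ ⌊ c <? D v ⌋) (C≗D u))

neg<+suc : ∀ d k → - + d < + suc k
neg<+suc d k = ≤-<-trans (neg-≤-pos {d} {0}) (+<+ (s≤s z≤n))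

module _ {n : ℕ} (G : Graph n) (H : VSet n) where

  IsIndependent : Set
  IsIndependent = ∀ x y → H x ≡ true → H y ≡ true → adj G x y ≡ false

  HasUniformOuterNbrs : ℕ → Set
  HasUniformOuterNbrs k = ∀ v → H v ≡ false → nbrsIn G H v ≡ k

  perturbedConfig : ℕ → Config n
  perturbedConfig k u = if H u then - + deg G u else + k

module _ {n : ℕ} (G : Graph n) (H : VSet n) (indep : IsIndependent G H) where

  independent-nonadjacent : ∀ {x y} → H x ≡ true → H y ≡ true → adj G x y ≡ true → ⊥
  independent-nonadjacent {x} {y} Hx Hy xy with trans (≡.sym (indep x y Hx Hy)) xy
  ... | ()

  independent-nbr : ∀ {v u} → H v ≡ true → adj G v u ≡ true → H u ≡ false
  independent-nbr {v} {u} Hv vu with H u in Hu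
  ... | false = refl
  ... | true  = ⊥-elim (independent-nonadjacent Hv Hu vu)

  nbrsIn-independent : ∀ {v} → H v ≡ true → nbrsIn G H v ≡ 0
  nbrsIn-independent {v} Hv = count-false nonadjacent
    where
    nonadjacent : ∀ u → (adj G v u ∧ H u) ≡ false
    nonadjacent u with H u in Hu
    ... | true  = trans (∧-identityʳ _) (indep v u Hv Hu)
    ... | false = ∧-zeroʳ _

  independent⇒CCD : ∀ {k} → HasUniformOuterNbrs G H k → IsCCD G H
  independent⇒CCD uniform = (λ _ _ Hx Hy xy → ⊥-elim (independent-nonadjacent Hx Hy xy)) , outside
    where
    outside : ∀ u v → H u ≡ false → H v ≡ false → adj G u v ≡ true → nbrsIn G H u ≡ nbrsIn G H v
    outside u v Hu Hv _ = trans (uniform u Hu) (≡.sym (uniform v Hv))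

  perturb-independent : ∀ {k} → HasUniformOuterNbrs G H k → ∀ u → perturb G H u ≡ perturbedConfig G H k u
  perturb-independent uniform u with H u in Hu
  ... | true  rewrite nbrsIn-independent Hu = +-identityˡ _
  ... | false rewrite uniform u Hu = +-identityʳ _

  module _ {k : ℕ} (uniform : HasUniformOuterNbrs G H (suc k)) where

    private
      C = perturbedConfig G H (suc k)

    C-inside : ∀ {v} → H v ≡ true → C v ≡ - + deg G v
    C-inside Hv rewrite Hv = refl

    C-outside : ∀ {v} → H v ≡ false → C v ≡ + suc k
    C-outside Hv rewrite Hv = refl

    C≤outer : ∀ u → C u ≤ + suc k
    C≤outer u with H u
    ... | true  = <⇒≤ (neg<+suc (deg G u) k)
    ... | false = ≤-refl

    C<outer : ∀ u → ⌊ C u <? + suc k ⌋ ≡ H u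
    C<outer u with H u
    ... | true  = isYes-true (_ <? _) (neg<+suc (deg G u) k)
    ... | false = isYes-false (_ <? _) (<-irrefl refl)

    inside<nbr : ∀ {v u} → H v ≡ true → adj G v u ≡ true → C v < C u
    inside<nbr {v} Hv vu rewrite Hv | independent-nbr Hv vu = neg<+suc (deg G v) k

    fire-inside : ∀ {v} → H v ≡ true → fire G C v ≡ + 0
    fire-inside {v} Hv = begin
      C v + + count (λ u → adj G v u ∧ ⌊ C v <? C u ⌋) - + count (λ u → adj G v u ∧ ⌊ C u <? C v ⌋)
        ≡⟨ cong₂ (λ a b → C v + + a - + b) (count-cong higher) (count-false lower) ⟩
      C v + + deg G v - + 0
        ≡⟨ cong (λ c → c + + deg G v - + 0) (C-inside Hv) ⟩
      - + deg G v + + deg G v - + 0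
        ≡⟨ trans (+-identityʳ _) (+-inverseˡ (+ deg G v)) ⟩
      + 0 ∎
      where
      higher : ∀ u → (adj G v u ∧ ⌊ C v <? C u ⌋) ≡ adj G v u
      higher u with adj G v u in vu
      ... | false = refl
      ... | true  = isYes-true (_ <? _) (inside<nbr Hv vu)
      lower : ∀ u → (adj G v u ∧ ⌊ C u <? C v ⌋) ≡ false
      lower u with adj G v u in vu
      ... | false = refl
      ... | true  = isYes-false (_ <? _) (<-asym (inside<nbr Hv vu))

    fire-outside : ∀ {v} → H v ≡ false → fire G C v ≡ + 0
    fire-outside {v} Hv = begin
      C v + + count (λ u → adj G v u ∧ ⌊ C v <? C u ⌋) - + count (λ u → adj G v u ∧ ⌊ C u <? C v ⌋)
        ≡⟨ cong (λ c → c + + count (λ u → adj G v u ∧ ⌊ c <? C u ⌋) - + count (λ u → adj G v u ∧ ⌊ C u <? c ⌋))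
                (C-outside Hv) ⟩
      + suc k + + count (λ u → adj G v u ∧ ⌊ + suc k <? C u ⌋) - + count (λ u → adj G v u ∧ ⌊ C u <? + suc k ⌋)
        ≡⟨ cong₂ (λ a b → + suc k + + a - + b) (count-false higher) (trans (count-cong lower) (uniform v Hv)) ⟩
      + suc k + + 0 - + suc k
        ≡⟨ trans (cong (_- + suc k) (+-identityʳ (+ suc k))) (+-inverseʳ (+ suc k)) ⟩
      + 0 ∎
      where
      higher : ∀ u → (adj G v u ∧ ⌊ + suc k <? C u ⌋) ≡ false
      higher u = trans (cong (adj G v u ∧_) (isYes-false (_ <? _) (≤⇒≯ (C≤outer u)))) (∧-zeroʳ _)
      lower : ∀ u → (adj G v u ∧ ⌊ C u <? + suc k ⌋) ≡ (adj G v u ∧ H u)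
      lower u = cong (adj G v u ∧_) (C<outer u)

    fire-perturbedConfig : ∀ v → fire G C v ≡ + 0
    fire-perturbedConfig v = byMembership (H v) refl
      where
      byMembership : ∀ b → H v ≡ b → fire G C v ≡ + 0
      byMembership true  = fire-inside
      byMembership false = fire-outside

  independent⇒0₂Invoking : ∀ {k} → HasUniformOuterNbrs G H (suc k) → Is0₂Invoking G H
  independent⇒0₂Invoking uniform v =
    trans (fire-cong G (perturb-independent uniform) v) (fire-perturbedConfig uniform v)

mainTheorem4 : {n : ℕ} (G : Graph n) (A : VSet n) →
    IsEfficientDominating G A → IsCCD G A × Is0₂Invoking G A
mainTheorem4 G A (indep , perfect) = independent⇒CCD G A indep perfect , independent⇒0₂Invoking G A indep perfect
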